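{- Let $\mathcal{O}$ be an $\mathcal{ELIF}$-ontology in normal form, let $\mathcal{D}_1,\mathcal{D}_2$ be databases that are satisfiable w.r.t.\ $\mathcal{O}$, and let $c_i\in\mathsf{adom}(\mathcal{D}_i)$ for $i\in\{1,2\}$. If $(\mathcal{D}_1,c_1)\preceq(\mathcal{D}_2,c_2)$, then for every concept name $A$, $\mathcal{D}_1,\mathcal{O}\models A(c_1)$ implies $\mathcal{D}_2,\mathcal{O}\models A(c_2)$.
   Context: Roles are role names $r$ or inverses $r^-$. An $\mathcal{ELIF}$-ontology is a finite set of concept inclusions between $\mathcal{ELI}$-concepts ($C,D::=\top\mid A\mid C\sqcap D\mid\exists R.C$) and functionality assertions $\mathsf{func}(R)$. It is in normal form if all its concept inclusions have one of the forms $\top\sqsubseteq A$, $A_1\sqcap A_2\sqsubseteq A$, $A_1\sqsubseteq\exists R.A_2$, $\exists R.A_1\sqsubseteq A_2$ with $A,A_1,A_2$ concept names. A database is a finite set of facts $A(c)$, $r(c,c')$ (with $r^-(a,b)$ standing for $r(b,a)$); it is satisfiable w.r.t.\ $\mathcal{O}$ if it has a model satisfying $\mathcal{O}$ (standard names assumption); $\mathcal{D},\mathcal{O}\models A(c)$ means $c\in A^{\mathcal{I}}$ in every model $\mathcal{I}$ of $\mathcal{D}$ and $\mathcal{O}$. A simulation from $\mathcal{D}_1$ to $\mathcal{D}_2$ is a relation $S\subseteq\mathsf{adom}(\mathcal{D}_1)\times\mathsf{adom}(\mathcal{D}_2)$ such that (i) $A(c)\in\mathcal{D}_1$ and $(c,c')\in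 S$ imply $A(c')\in\mathcal{D}_2$, and (ii) $R(c_1,c_2)\in\mathcal{D}_1$ ($R$ a role) and $(c_1,c_1')\in S$ imply there is $c_2'$ with $R(c_1',c_2')\in\mathcal{D}_2$ and $(c_2,c_2')\in S$. $(\mathcal{D}_1,c)\preceq(\mathcal{D}_2,c')$ means there is such a simulation containing $(c,c')$. -}

module Defs where

open import Data.Nat using (ℕ)
open import Data.Unit using (⊤)
open import Data.Product using (Σ; _×_)
open import Data.List using (List)
open import Data.List.Membership.Propositional using (_∈_)
open import Data.List.Relation.Unary.All using (All)
open import Data.Sum using (_⊎_)
open import Relation.Binary.PropositionalEquality using (_≡_)

ConceptName : Set
ConceptName = ℕ

RoleName : Set
RoleName = ℕ

Const : Set
Const = ℕ

data Role : Set where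
  rn  : RoleName → Role
  inv : RoleName → Role

data Concept : Set where
  top  : Concept
  name : ConceptName → Concept
  _⊓_  : Concept → Concept → Concept
  ex   : Role → Concept → Concept

data Axiom : Set where
  _⊑_  : Concept → Concept → Axiom
  func : Role → Axiom

Ontology : Set
Ontology = List Axiom

data NormalAxiom : Axiom → Set where
  nf-top  : ∀ A → NormalAxiom (top ⊑ name A)
  nf-conj : ∀ A₁ A₂ A → NormalAxiom ((name A₁ ⊓ name A₂) ⊑ name A)
  nf-ex-r : ∀ A₁ R A₂ → NormalAxiom (name A₁ ⊑ ex R (name A₂))
  nf-ex-l : ∀ R A₁ A₂ → NormalAxiom (ex R (name A₁) ⊑ name A₂)
  nf-func : ∀ R → NormalAxiom (func R)

NormalForm : Ontology → Set
NormalForm O = All NormalAxiom O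

data Fact : Set where
  cfact : ConceptName → Const → Fact
  rfact : RoleName → Const → Const → Fact

Database : Set
Database = List Fact

RoleFactIn : Database → Role → Const → Const → Set
RoleFactIn D (rn r)  a b = rfact r a b ∈ D
RoleFactIn D (inv r) a b = rfact r b a ∈ D

data OccursIn (c : Const) : Fact → Set where
  occ-c  : ∀ A → OccursIn c (cfact A c)
  occ-r1 : ∀ r b → OccursIn c (rfact r c b)
  occ-r2 : ∀ r a → OccursIn c (rfact r a c)

InAdom : Const → Database → Set
InAdom c D = Σ Fact λ f → f ∈ D × OccursIn c f

-- Interpretations under the standard names assumption: every constant
-- denotes a distinct domain element (injective naming).
record Interpretation : Set₁ where
  field
    Δ      : Set
    ind    : Const → Δ
    ind-inj : ∀ a b → ind a ≡ ind b → a ≡ b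
    conI   : ConceptName → Δ → Set
    roleI  : RoleName → Δ → Δ → Set

open Interpretation public

roleExt : (I : Interpretation) → Role → Δ I → Δ I → Set
roleExt I (rn r)  d e = roleI I r d e
roleExt I (inv r) d e = roleI I r e d

conceptExt : (I : Interpretation) → Concept → Δ I → Set
conceptExt I top        d = ⊤
conceptExt I (name A)   d = conI I A d
conceptExt I (C ⊓ C')   d = conceptExt I C d × conceptExt I C' d
conceptExt I (ex R C)   d = Σ (Δ I) λ e → roleExt I R d e × conceptExt I C e

SatAxiom : Interpretation → Axiom → Set
SatAxiom I (C ⊑ C') = ∀ d → conceptExt I C d → conceptExt I C' d
SatAxiom I (func R) = ∀ d e e' → roleExt I R d e → roleExt I R d e' → e ≡ e'

ModelOfO : Interpretation → Ontology → Set
ModelOfO I O = All (SatAxiom I) O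

SatFact : Interpretation → Fact → Set
SatFact I (cfact A c)   = conI I A (ind I c)
SatFact I (rfact r a b) = roleI I r (ind I a) (ind I b)

ModelOfD : Interpretation → Database → Set
ModelOfD I D = All (SatFact I) D

Satisfiable : Database → Ontology → Set₁
Satisfiable D O = Σ Interpretation λ I → ModelOfD I D × ModelOfO I O

Entails : Database → Ontology → ConceptName → Const → Set₁
Entails D O A c = ∀ (I : Interpretation) → ModelOfD I D → ModelOfO I O → conI I A (ind I c)

record IsSimulation (D₁ D₂ : Database) (S : Const → Const → Set) : Set where
  field
    dom  : ∀ c c' → S c c' → InAdom c D₁ × InAdom c' D₂
    atom : ∀ A c c' → cfact A c ∈ D₁ → S c c' → cfact A c' ∈ D₂
    edge : ∀ (R : Role) c₁ c₂ c₁' → RoleFactIn D₁ R c₁ c₂ → S c₁ c₁' →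
           Σ Const λ c₂' → RoleFactIn D₂ R c₁' c₂' × S c₂ c₂'

Simulated : Database → Const → Database → Const → Set₁
Simulated D₁ c D₂ c' =
  Σ (Const → Const → Set) λ S → IsSimulation D₁ D₂ S × S c c'

{-# OPTIONS --safe #-}
module Submission where

-- From D₁ alone we build a canonical model J of D₁ and O.  Its elements are the
-- constants and a tree of anonymous successors, and each element carries a type: a
-- finite set of concept names, computed as a least fixpoint of the rules read off
-- the normal form (the type of a node may use the closed types of the successors
-- it would receive, and conversely).  J is a model of D₁ and O, so D₁, O ⊨ A(c₁)
-- puts A in the type of c₁.  Every rule is valid in every model I of O, and the
-- simulation carries the facts and edges of D₁ into D₂; by induction along the
-- fixpoint iteration the type of c₁ therefore holds at c₂ in every model of D₂
-- and O.
--
-- Functional roles are why types are computed by iteration rather than defined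
-- inductively: an existential restriction on a functional role must reuse an
-- existing neighbour when there is one, which J can only decide for decidable
-- types.  Satisfiability of D₁ is used only to know that D₁ itself respects the
-- functionality assertions.

open import Defs
open import Level using (Level)
open import Data.Bool using (true)
open import Data.Empty using (⊥)
open import Data.Fin.Properties using (¬∀⟶∃¬) renaming (any? to anyFin?)
open import Data.Fin.Subset using (Subset; inside; outside; _∪_; _⊆_; ∣_∣) renaming (_∈_ to _∈ᶠ_)
open import Data.Fin.Subset.Properties
  using (_⊆?_; ⊆-refl; ⊆-trans; p⊆p∪q; q⊆p∪q; x∈p∪q⁻; ∣p∣≤n; p⊆q⇒∣p∣≤∣q∣; p⊂q⇒∣p∣<∣q∣)
  renaming (_∈?_ to _∈ᶠ?_)
open import Data.List using (List; []; _∷_; _++_; map; length; lookup)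
open import Data.List.Membership.Propositional using (_∈_; _∉_; find; lose)
open import Data.List.Membership.Propositional.Properties using (∈-++⁺ˡ; ∈-++⁺ʳ; ∈-map⁺)
open import Data.List.Membership.DecPropositional using () renaming (_∈?_ to ∈?[_])
open import Data.List.Relation.Unary.All as All using (All; []; _∷_; all?)
open import Data.List.Relation.Unary.Any using (Any; here; there; any?; index)
open import Data.List.Relation.Unary.Any.Properties using (lookup-index)
open import Data.Nat using (ℕ; zero; suc; _≤_; _<_; _+_; _*_; z≤n; s≤s; _≟_)
open import Data.Nat.Properties using (≤-trans; <-≤-trans; +-mono-≤; +-mono-<-≤; +-mono-≤-<; n≮n)
open import Data.Product using (∃-syntax; ∃₂; _×_; _,_; proj₁; proj₂)
open import Data.Sum using (_⊎_; inj₁; inj₂) renaming (map to ⊎-map)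
open import Data.Vec using ([]; _∷_; tabulate)
open import Data.Vec.Properties using (lookup∘tabulate; []=⇒lookup; lookup⇒[]=)
open import Function using (_∘_; id; const)
open import Relation.Binary using (DecidableEquality)
open import Relation.Binary.PropositionalEquality using (_≡_; refl; sym; trans; subst; cong)
open import Relation.Nullary
  using (¬_; Dec; yes; no; does; map′; _×-dec_; _⊎-dec_; _→-dec_; ¬?; decidable-stable; contradiction)
open import Relation.Nullary.Decidable using (dec-true)
open import Relation.Unary using (Pred; Decidable)

-- Inflationary iteration on finite subsets

p⊆q⇒q⊈p⇒∣p∣<∣q∣ : ∀ {m} {p q : Subset m} → p ⊆ q → ¬ q ⊆ p → ∣ p ∣ < ∣ q ∣
p⊆q⇒q⊈p⇒∣p∣<∣q∣ {m} {p} {q} p⊆q q⊈p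
  with ¬∀⟶∃¬ m (λ i → i ∈ᶠ q → i ∈ᶠ p) (λ i → (i ∈ᶠ? q) →-dec (i ∈ᶠ? p)) (λ q⊆p → q⊈p (q⊆p _))
... | i , i∉q⇒p = p⊂q⇒∣p∣<∣q∣ (p⊆q , i , i∈q , λ i∈p → i∉q⇒p (const i∈p))
  where i∈q = decidable-stable (i ∈ᶠ? q) λ i∉q → i∉q⇒p λ i∈q → contradiction i∈q i∉q

allSubsets : ∀ n → List (Subset n)
allSubsets zero    = [] ∷ []
allSubsets (suc n) = map (inside ∷_) (allSubsets n) ++ map (outside ∷_) (allSubsets n)

∈-allSubsets : ∀ {n} (p : Subset n) → p ∈ allSubsets n
∈-allSubsets []            = here refl
∈-allSubsets (inside ∷ p)  = ∈-++⁺ˡ (∈-map⁺ _ (∈-allSubsets p))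
∈-allSubsets (outside ∷ p) = ∈-++⁺ʳ _ (∈-map⁺ _ (∈-allSubsets p))

module Stabilisation {X : Set} {m : ℕ} (keys : List X) (extra : (X → Subset m) → X → Subset m) where

  step : (X → Subset m) → X → Subset m
  step f x = f x ∪ extra f x

  inflationary : ∀ f x → f x ⊆ step f x
  inflationary f x = p⊆p∪q (extra f x)

  stage : (X → Subset m) → ℕ → X → Subset m
  stage f₀ zero    = f₀
  stage f₀ (suc k) = step (stage f₀ k)

  stage-induction : ∀ {ℓ} (P : (X → Subset m) → Set ℓ) {f₀} →
                    P f₀ → (∀ {f} → P f → P (step f)) → ∀ k → P (stage f₀ k)
  stage-induction P base next zero    = base
  stage-induction P base next (suc k) = next (stage-induction P base next k)

  PostFixed : (X → Subset m) → Set
  PostFixed f = All (λ x → step f x ⊆ f x) keys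

  weight : List X → (X → Subset m) → ℕ
  weight []       f = 0
  weight (x ∷ xs) f = ∣ f x ∣ + weight xs f

  weight-bounded : ∀ xs f → weight xs f ≤ length xs * m
  weight-bounded []       f = z≤n
  weight-bounded (x ∷ xs) f = +-mono-≤ (∣p∣≤n (f x)) (weight-bounded xs f)

  weight-step : ∀ xs f → weight xs f ≤ weight xs (step f)
  weight-step []       f = z≤n
  weight-step (x ∷ xs) f = +-mono-≤ (p⊆q⇒∣p∣≤∣q∣ (inflationary f x)) (weight-step xs f)

  weight-step-< : ∀ xs f → ¬ All (λ x → step f x ⊆ f x) xs → weight xs f < weight xs (step f)
  weight-step-< []       f ¬fixed = contradiction [] ¬fixed
  weight-step-< (x ∷ xs) f ¬fixed with step f x ⊆? f x
  ... | yes fixed =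
    +-mono-≤-< (p⊆q⇒∣p∣≤∣q∣ (inflationary f x)) (weight-step-< xs f (λ rest → ¬fixed (fixed ∷ rest)))
  ... | no ¬fixed = +-mono-<-≤ (p⊆q⇒q⊈p⇒∣p∣<∣q∣ (inflationary f x) ¬fixed) (weight-step xs f)

  module _ (f₀ : X → Subset m) where

    postFixed-or-heavy : ∀ k → (∃[ j ] PostFixed (stage f₀ j)) ⊎ k ≤ weight keys (stage f₀ k)
    postFixed-or-heavy zero = inj₂ z≤n
    postFixed-or-heavy (suc k) with postFixed-or-heavy k
    ... | inj₁ found = inj₁ found
    ... | inj₂ heavy with all? (λ x → step (stage f₀ k) x ⊆? stage f₀ k x) keys
    ...   | yes fixed = inj₁ (k , fixed)
    ...   | no ¬fixed = inj₂ (<-≤-trans (s≤s heavy) (weight-step-< keys (stage f₀ k) ¬fixed))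

    stabilises : ∃[ k ] PostFixed (stage f₀ k)
    stabilises with postFixed-or-heavy (suc (length keys * m))
    ... | inj₁ found = found
    ... | inj₂ heavy = contradiction (≤-trans heavy (weight-bounded keys _)) (n≮n _)

module Selection {A : Set} (_≟_ : DecidableEquality A) (U : List A) where

  infix 4 _∈ˢ_ _∈ˢ?_

  _∈ˢ_ : A → Subset (length U) → Set
  a ∈ˢ S = ∃[ i ] lookup U i ≡ a × i ∈ᶠ S

  _∈ˢ?_ : ∀ a S → Dec (a ∈ˢ S)
  a ∈ˢ? S = anyFin? λ i → (lookup U i ≟ a) ×-dec (i ∈ᶠ? S)

  ∈ˢ-mono : ∀ {a S S′} → S ⊆ S′ → a ∈ˢ S → a ∈ˢ S′
  ∈ˢ-mono S⊆S′ (i , eq , i∈S) = i , eq , S⊆S′ i∈S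

  ∈ˢ-∪⁻ : ∀ {a} S S′ → a ∈ˢ S ∪ S′ → a ∈ˢ S ⊎ a ∈ˢ S′
  ∈ˢ-∪⁻ S S′ (i , eq , i∈) = ⊎-map (λ i∈S → i , eq , i∈S) (λ i∈S′ → i , eq , i∈S′) (x∈p∪q⁻ S S′ i∈)

  select : ∀ {ℓ} {P : Pred A ℓ} → Decidable P → Subset (length U)
  select P? = tabulate λ i → does (P? (lookup U i))

  module _ {ℓ : Level} {P : Pred A ℓ} (P? : Decidable P) where

    ∈ˢ-select⁻ : ∀ {a} → a ∈ˢ select P? → P a
    ∈ˢ-select⁻ (i , refl , i∈) = decided (trans (sym (lookup∘tabulate _ i)) ([]=⇒lookup i∈))
      where
      decided : ∀ {a} → does (P? a) ≡ true → P a
      decided {a} holds with P? a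
      ... | yes pa = pa

    ∈ˢ-select⁺ : ∀ {a} → a ∈ U → P a → a ∈ˢ select P?
    ∈ˢ-select⁺ {a} a∈U pa =
      index a∈U , sym a≡ ,
      lookup⇒[]= (index a∈U) _ (trans (lookup∘tabulate _ (index a∈U)) (dec-true (P? _) (subst P a≡ pa)))
      where a≡ = lookup-index a∈U

-- Roles, databases and normal-form ontologies

converse : Role → Role
converse (rn r)  = inv r
converse (inv r) = rn r

converse-involutive : ∀ R → converse (converse R) ≡ R
converse-involutive (rn r)  = refl
converse-involutive (inv r) = refl

roleExt-converse : ∀ I R {d e} → roleExt I R d e → roleExt I (converse R) e d
roleExt-converse I (rn r)  rel = rel
roleExt-converse I (inv r) rel = rel

RoleFactIn-converse : ∀ D R {c e} → RoleFactIn D R c e → RoleFactIn D (converse R) e c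
RoleFactIn-converse D (rn r)  fact = fact
RoleFactIn-converse D (inv r) fact = fact

_≟ᴿ_ : DecidableEquality Role
rn r  ≟ᴿ rn s  = map′ (cong rn) (λ { refl → refl }) (r ≟ s)
inv r ≟ᴿ inv s = map′ (cong inv) (λ { refl → refl }) (r ≟ s)
rn _  ≟ᴿ inv _ = no λ ()
inv _ ≟ᴿ rn _  = no λ ()

_≟ᶠ_ : DecidableEquality Fact
cfact A c   ≟ᶠ cfact B d   =
  map′ (λ { (refl , refl) → refl }) (λ { refl → refl , refl }) ((A ≟ B) ×-dec (c ≟ d))
rfact r a b ≟ᶠ rfact s c d =
  map′ (λ { (refl , refl , refl) → refl }) (λ { refl → refl , refl , refl })
       ((r ≟ s) ×-dec (a ≟ c) ×-dec (b ≟ d))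
cfact _ _   ≟ᶠ rfact _ _ _ = no λ ()
rfact _ _ _ ≟ᶠ cfact _ _   = no λ ()

Incident : Const → (Role → Const → Set) → Fact → Set
Incident c P (cfact _ _)   = ⊥
Incident c P (rfact r a b) = (a ≡ c × P (rn r) b) ⊎ (b ≡ c × P (inv r) a)

AnyNeighbour : Database → Const → (Role → Const → Set) → Set
AnyNeighbour D c P = Any (Incident c P) D

anyNeighbour? : ∀ D c {P} → (∀ R e → Dec (P R e)) → Dec (AnyNeighbour D c P)
anyNeighbour? D c {P} P? = any? incident? D
  where
  incident? : ∀ f → Dec (Incident c P f)
  incident? (cfact _ _)   = no λ ()
  incident? (rfact r a b) = ((a ≟ c) ×-dec P? (rn r) b) ⊎-dec ((b ≟ c) ×-dec P? (inv r) a)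

module _ {D : Database} {c : Const} {P : Role → Const → Set} where

  anyNeighbour⁺ : ∀ R {e} → RoleFactIn D R c e → P R e → AnyNeighbour D c P
  anyNeighbour⁺ (rn r)  fact p = lose fact (inj₁ (refl , p))
  anyNeighbour⁺ (inv r) fact p = lose fact (inj₂ (refl , p))

  anyNeighbour⁻ : AnyNeighbour D c P → ∃₂ λ R e → RoleFactIn D R c e × P R e
  anyNeighbour⁻ neighbour with find neighbour
  ... | rfact r a b , fact , inj₁ (refl , p) = rn r , b , fact , p
  ... | rfact r a b , fact , inj₂ (refl , p) = inv r , a , fact , p

constants : Database → List Const
constants []                  = []
constants (cfact _ c   ∷ D) = c ∷ constants D
constants (rfact _ a b ∷ D) = a ∷ b ∷ constants D

adom⊆constants : ∀ {c} D → InAdom c D → c ∈ constants D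
adom⊆constants (cfact _ _   ∷ D) (_ , here refl , occ-c _)    = here refl
adom⊆constants (rfact _ _ _ ∷ D) (_ , here refl , occ-r1 _ _) = here refl
adom⊆constants (rfact _ _ _ ∷ D) (_ , here refl , occ-r2 _ _) = there (here refl)
adom⊆constants (cfact _ _   ∷ D) (f , there f∈D , occ) = there (adom⊆constants D (f , f∈D , occ))
adom⊆constants (rfact _ _ _ ∷ D) (f , there f∈D , occ) = there (there (adom⊆constants D (f , f∈D , occ)))

roleFact-source : ∀ D R {c e} → RoleFactIn D R c e → InAdom c D
roleFact-source D (rn r)  fact = _ , fact , occ-r1 r _
roleFact-source D (inv r) fact = _ , fact , occ-r2 r _

conceptNames : Database → List ConceptName
conceptNames []                  = []
conceptNames (cfact A _   ∷ D) = A ∷ conceptNames D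
conceptNames (rfact _ _ _ ∷ D) = conceptNames D

∈-conceptNames : ∀ {A c} D → cfact A c ∈ D → A ∈ conceptNames D
∈-conceptNames (cfact _ _   ∷ D) (here refl) = here refl
∈-conceptNames (cfact _ _   ∷ D) (there fact) = there (∈-conceptNames D fact)
∈-conceptNames (rfact _ _ _ ∷ D) (there fact) = ∈-conceptNames D fact

roleFact-sat : ∀ {I D} → ModelOfD I D → ∀ R {a b} → RoleFactIn D R a b → roleExt I R (ind I a) (ind I b)
roleFact-sat I⊨D (rn r)  fact = All.lookup I⊨D fact
roleFact-sat I⊨D (inv r) fact = All.lookup I⊨D fact

record NormalOntology : Set where
  field
    tops     : List ConceptName
    conjs    : List (ConceptName × ConceptName × ConceptName)
    exRights : List (ConceptName × Role × ConceptName)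
    exLefts  : List (Role × ConceptName × ConceptName)
    funcs    : List Role

module _ where

  open NormalOntology

  normalise : (O : Ontology) → NormalForm O → NormalOntology
  normalise []      []                      = record { tops = [] ; conjs = [] ; exRights = [] ; exLefts = [] ; funcs = [] }
  normalise (_ ∷ O) (nf-top A        ∷ nf) = record N { tops     = A ∷ tops N }              where N = normalise O nf
  normalise (_ ∷ O) (nf-conj A₁ A₂ A ∷ nf) = record N { conjs    = (A₁ , A₂ , A) ∷ conjs N }  where N = normalise O nf
  normalise (_ ∷ O) (nf-ex-r A₁ R A₂ ∷ nf) = record N { exRights = (A₁ , R , A₂) ∷ exRights N } where N = normalise O nf
  normalise (_ ∷ O) (nf-ex-l R A₁ A₂ ∷ nf) = record N { exLefts  = (R , A₁ , A₂) ∷ exLefts N }  where N = normalise O nf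
  normalise (_ ∷ O) (nf-func R       ∷ nf) = record N { funcs    = R ∷ funcs N }             where N = normalise O nf

  record _⊨ₙ_ (I : Interpretation) (N : NormalOntology) : Set where
    constructor satisfies
    field
      tops-sat     : All (λ A → SatAxiom I (top ⊑ name A)) (tops N)
      conjs-sat    : All (λ (A₁ , A₂ , A) → SatAxiom I ((name A₁ ⊓ name A₂) ⊑ name A)) (conjs N)
      exRights-sat : All (λ (A₁ , R , A₂) → SatAxiom I (name A₁ ⊑ ex R (name A₂))) (exRights N)
      exLefts-sat  : All (λ (R , A₁ , A₂) → SatAxiom I (ex R (name A₁) ⊑ name A₂)) (exLefts N)
      funcs-sat    : All (λ R → SatAxiom I (func R)) (funcs N)

  module _ {I : Interpretation} where

    ⊨-normalise : ∀ O nf → ModelOfO I O → I ⊨ₙ normalise O nf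
    ⊨-normalise [] [] [] = satisfies [] [] [] [] []
    ⊨-normalise (_ ∷ O) (n ∷ nf) (sat ∷ sats) with n | ⊨-normalise O nf sats
    ... | nf-top _      | satisfies t c r l f = satisfies (sat ∷ t) c r l f
    ... | nf-conj _ _ _ | satisfies t c r l f = satisfies t (sat ∷ c) r l f
    ... | nf-ex-r _ _ _ | satisfies t c r l f = satisfies t c (sat ∷ r) l f
    ... | nf-ex-l _ _ _ | satisfies t c r l f = satisfies t c r (sat ∷ l) f
    ... | nf-func _     | satisfies t c r l f = satisfies t c r l (sat ∷ f)

    normalise-⊨ : ∀ O nf → I ⊨ₙ normalise O nf → ModelOfO I O
    normalise-⊨ []      []                    _                           = []
    normalise-⊨ (_ ∷ O) (nf-top _      ∷ nf) (satisfies (t ∷ ts) c r l f) = t ∷ normalise-⊨ O nf (satisfies ts c r l f)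
    normalise-⊨ (_ ∷ O) (nf-conj _ _ _ ∷ nf) (satisfies t (c ∷ cs) r l f) = c ∷ normalise-⊨ O nf (satisfies t cs r l f)
    normalise-⊨ (_ ∷ O) (nf-ex-r _ _ _ ∷ nf) (satisfies t c (r ∷ rs) l f) = r ∷ normalise-⊨ O nf (satisfies t c rs l f)
    normalise-⊨ (_ ∷ O) (nf-ex-l _ _ _ ∷ nf) (satisfies t c r (l ∷ ls) f) = l ∷ normalise-⊨ O nf (satisfies t c r ls f)
    normalise-⊨ (_ ∷ O) (nf-func _     ∷ nf) (satisfies t c r l (f ∷ fs)) = f ∷ normalise-⊨ O nf (satisfies t c r l fs)

  functional-facts : ∀ {K D N} → ModelOfD K D → K ⊨ₙ N →
                     ∀ {R c e e′} → R ∈ funcs N → RoleFactIn D R c e → RoleFactIn D R c e′ → e ≡ e′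
  functional-facts {K} K⊨D K⊨N {R} {c} {e} {e′} R∈ fact fact′ =
    ind-inj K e e′ (All.lookup funcs-sat R∈ (ind K c) (ind K e) (ind K e′)
                                (roleFact-sat K⊨D R fact) (roleFact-sat K⊨D R fact′))
    where open _⊨ₙ_ K⊨N

-- The canonical model

module Canonical (N : NormalOntology) (D : Database) where

  open NormalOntology N

  targets : ∀ {X Y : Set} → List (X × Y × ConceptName) → List ConceptName
  targets = map (proj₂ ∘ proj₂)

  Names : List ConceptName
  Names = tops ++ targets conjs ++ targets exRights ++ targets exLefts ++ conceptNames D

  top∈Names : ∀ {A} → A ∈ tops → A ∈ Names
  top∈Names = ∈-++⁺ˡ

  conj∈Names : ∀ {A₁ A₂ A} → (A₁ , A₂ , A) ∈ conjs → A ∈ Names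
  conj∈Names ax = ∈-++⁺ʳ tops (∈-++⁺ˡ (∈-map⁺ _ ax))

  exRight∈Names : ∀ {A₁ R A₂} → (A₁ , R , A₂) ∈ exRights → A₂ ∈ Names
  exRight∈Names ax = ∈-++⁺ʳ tops (∈-++⁺ʳ (targets conjs) (∈-++⁺ˡ (∈-map⁺ _ ax)))

  exLeft∈Names : ∀ {R A₁ A₂} → (R , A₁ , A₂) ∈ exLefts → A₂ ∈ Names
  exLeft∈Names ax =
    ∈-++⁺ʳ tops (∈-++⁺ʳ (targets conjs) (∈-++⁺ʳ (targets exRights) (∈-++⁺ˡ (∈-map⁺ _ ax))))

  fact∈Names : ∀ {A c} → cfact A c ∈ D → A ∈ Names
  fact∈Names fact =
    ∈-++⁺ʳ tops (∈-++⁺ʳ (targets conjs) (∈-++⁺ʳ (targets exRights)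
      (∈-++⁺ʳ (targets exLefts) (∈-conceptNames D fact))))

  open Selection _≟_ Names public

  Type : Set
  Type = Subset (length Names)

  functional? : ∀ R → Dec (R ∈ funcs)
  functional? R = ∈?[ _≟ᴿ_ ] R funcs

  Demands : Type → Role → ConceptName → Set
  Demands S R B = Any (λ (A₁ , R′ , A₂) → R′ ≡ R × A₂ ≡ B × A₁ ∈ˢ S) exRights

  Triggers : Type → Role → Set
  Triggers S R = Any (λ (A₁ , R′ , _) → R′ ≡ R × A₁ ∈ˢ S) exRights

  Forces : Type → Role → ConceptName → Set
  Forces T R A = Any (λ (R′ , B , C) → R′ ≡ R × C ≡ A × B ∈ˢ T) exLefts

  -- A node with an R-neighbour of type T must satisfy A: by an axiom ∃R.B ⊑ A, or because the
  -- neighbour demands an A-neighbour along the functional role converse R, which can only be this node.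
  Constrains : Type → Role → ConceptName → Set
  Constrains T R A = Forces T R A ⊎ (converse R ∈ funcs × Demands T (converse R) A)

  demands? : ∀ S R B → Dec (Demands S R B)
  demands? S R B = any? (λ (A₁ , R′ , A₂) → (R′ ≟ᴿ R) ×-dec (A₂ ≟ B) ×-dec (A₁ ∈ˢ? S)) exRights

  triggers? : ∀ S R → Dec (Triggers S R)
  triggers? S R = any? (λ (A₁ , R′ , _) → (R′ ≟ᴿ R) ×-dec (A₁ ∈ˢ? S)) exRights

  constrains? : ∀ T R A → Dec (Constrains T R A)
  constrains? T R A =
    any? (λ (R′ , B , C) → (R′ ≟ᴿ R) ×-dec (C ≟ A) ×-dec (B ∈ˢ? T)) exLefts
    ⊎-dec (functional? (converse R) ×-dec demands? T (converse R) A)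

  demanded-constrains : ∀ {S R B} → R ∈ funcs → Demands S R B → Constrains S (converse R) B
  demanded-constrains {S} {R} {B} R∈ demand =
    inj₂ (subst (λ R′ → R′ ∈ funcs × Demands S R′ B) (sym (converse-involutive R)) (R∈ , demand))

  seed : Type → Role → Type
  seed S R = select (constrains? S (converse R))

  witnessSeed : Type → Role → ConceptName → Type
  witnessSeed S R B = select (λ B′ → (B ≟ B′) ⊎-dec constrains? S (converse R) B′)

  childSeed : Type → Role → ConceptName → Type
  childSeed S R B with functional? R
  ... | yes _ = seed S R
  ... | no  _ = witnessSeed S R B

  childSeed-functional : ∀ {S R} B → R ∈ funcs → childSeed S R B ≡ seed S R
  childSeed-functional {R = R} B R∈ with functional? R
  ... | yes _   = refl
  ... | no  R∉ = contradiction R∈ R∉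

  childSeed-witness : ∀ {S R} B → R ∉ funcs → childSeed S R B ≡ witnessSeed S R B
  childSeed-witness {R = R} B R∉ with functional? R
  ... | yes R∈ = contradiction R∈ R∉
  ... | no  _  = refl

  -- One rule application at a node of type S; f stands for the closure operator being computed,
  -- applied to the seed of the anonymous child that an existential restriction would create.
  Fires : (Type → Type) → Type → ConceptName → Set
  Fires f S A = A ∈ tops
              ⊎ Any (λ (B₁ , B₂ , B) → B ≡ A × B₁ ∈ˢ S × B₂ ∈ˢ S) conjs
              ⊎ Any (λ (B₁ , R , B₂) → B₁ ∈ˢ S × Constrains (f (childSeed S R B₂)) R A) exRights

  fires? : ∀ f S A → Dec (Fires f S A)
  fires? f S A =
    ∈?[ _≟_ ] A tops
    ⊎-dec any? (λ (B₁ , B₂ , B) → (B ≟ A) ×-dec (B₁ ∈ˢ? S) ×-dec (B₂ ∈ˢ? S)) conjs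
    ⊎-dec any? (λ (B₁ , R , B₂) → (B₁ ∈ˢ? S) ×-dec constrains? (f (childSeed S R B₂)) R A) exRights

  rules : (Type → Type) → Type → Type
  rules f S = select (fires? f S)

  module ClosureStages = Stabilisation (allSubsets (length Names)) (λ f K → rules f (f K))

  -- Opaque so that unification never unfolds the stabilisation proof, i.e. runs the iteration.
  opaque
    closure : Type → Type
    closure = ClosureStages.stage id (proj₁ (ClosureStages.stabilises id))

    closure-postFixed : ∀ K → ClosureStages.step closure K ⊆ closure K
    closure-postFixed K = All.lookup (proj₂ (ClosureStages.stabilises id)) (∈-allSubsets K)

    closure-induction : (P : (Type → Type) → Set) →
                        P id → (∀ {f} → P f → P (ClosureStages.step f)) → P closure
    closure-induction P base next = ClosureStages.stage-induction P base next (proj₁ (ClosureStages.stabilises id))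

  closure-extensive : ∀ K → K ⊆ closure K
  closure-extensive = closure-induction (λ f → ∀ K → K ⊆ f K)
    (λ _ → ⊆-refl) (λ {f} K⊆ K → ⊆-trans (K⊆ K) (ClosureStages.inflationary f K))

  Closed : Type → Set
  Closed S = ∀ {A} → A ∈ Names → Fires closure S A → A ∈ˢ S

  closure-closed : ∀ K → Closed (closure K)
  closure-closed K A∈ fires =
    ∈ˢ-mono (⊆-trans (q⊆p∪q (closure K) (rules closure (closure K))) (closure-postFixed K))
            (∈ˢ-select⁺ (fires? closure (closure K)) A∈ fires)

  facts : Const → Type
  facts c = select (λ A → ∈?[ _≟ᶠ_ ] (cfact A c) D)

  neighbourConstraints : (Const → Type) → Const → Type
  neighbourConstraints g c = select (λ A → anyNeighbour? D c (λ R e → constrains? (g e) R A))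

  module AboxStages = Stabilisation (constants D) (λ g c → rules closure (g c) ∪ neighbourConstraints g c)

  opaque
    aboxTypes : Const → Type
    aboxTypes = AboxStages.stage facts (proj₁ (AboxStages.stabilises facts))

    aboxTypes-postFixed : ∀ {c} → c ∈ constants D → AboxStages.step aboxTypes c ⊆ aboxTypes c
    aboxTypes-postFixed = All.lookup (proj₂ (AboxStages.stabilises facts))

    aboxTypes-induction : (P : (Const → Type) → Set) →
                          P facts → (∀ {g} → P g → P (AboxStages.step g)) → P aboxTypes
    aboxTypes-induction P base next = AboxStages.stage-induction P base next (proj₁ (AboxStages.stabilises facts))

  facts⊆aboxTypes : ∀ c → facts c ⊆ aboxTypes c
  facts⊆aboxTypes = aboxTypes-induction (λ g → ∀ c → facts c ⊆ g c)
    (λ _ → ⊆-refl) (λ {g} facts⊆ c → ⊆-trans (facts⊆ c) (AboxStages.inflationary g c))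

  aboxTypes-closed : ∀ {c} → c ∈ constants D → Closed (aboxTypes c)
  aboxTypes-closed {c} c∈ A∈ fires = ∈ˢ-mono rules⊆ (∈ˢ-select⁺ (fires? closure (aboxTypes c)) A∈ fires)
    where
    rules⊆ : rules closure (aboxTypes c) ⊆ aboxTypes c
    rules⊆ = ⊆-trans (⊆-trans (p⊆p∪q (neighbourConstraints aboxTypes c)) (q⊆p∪q (aboxTypes c) _))
                     (aboxTypes-postFixed c∈)

  aboxTypes-constrained : ∀ {c A} → c ∈ constants D → A ∈ Names →
                          AnyNeighbour D c (λ R e → Constrains (aboxTypes e) R A) → A ∈ˢ aboxTypes c
  aboxTypes-constrained {c} c∈ A∈ neighbour =
    ∈ˢ-mono constrained⊆
      (∈ˢ-select⁺ (λ A → anyNeighbour? D c (λ R e → constrains? (aboxTypes e) R A)) A∈ neighbour)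
    where
    constrained⊆ : neighbourConstraints aboxTypes c ⊆ aboxTypes c
    constrained⊆ = ⊆-trans (⊆-trans (q⊆p∪q (rules closure (aboxTypes c)) (neighbourConstraints aboxTypes c))
                                    (q⊆p∪q (aboxTypes c) _))
                           (aboxTypes-postFixed c∈)

  -- Constants outside adom(D) are not keys of the iteration, so only the closure of their stage is closed.
  individualType : Const → Type
  individualType c with ∈?[ _≟_ ] c (constants D)
  ... | yes _ = aboxTypes c
  ... | no  _ = closure (aboxTypes c)

  individualType-adom : ∀ {c} → c ∈ constants D → individualType c ≡ aboxTypes c
  individualType-adom {c} c∈ with ∈?[ _≟_ ] c (constants D)
  ... | yes _   = refl
  ... | no  c∉ = contradiction c∈ c∉

  individualType-closed : ∀ c → Closed (individualType c)
  individualType-closed c with ∈?[ _≟_ ] c (constants D)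
  ... | yes c∈ = aboxTypes-closed c∈
  ... | no  _  = closure-closed (aboxTypes c)

  -- Along a functional role R a node gets at most one anonymous neighbour, successor x R, and only
  -- when it has no R-neighbour yet; along other roles it gets one witness per demanded concept name.
  data Node : Set where
    individual : Const → Node
    successor  : Node → Role → Node
    witness    : Node → Role → ConceptName → Node

  type : Node → Type
  type (individual c)  = individualType c
  type (successor x R) = closure (seed (type x) R)
  type (witness x R B) = closure (witnessSeed (type x) R B)

  successor-seeded : ∀ {x R A} → A ∈ Names → Constrains (type x) (converse R) A → A ∈ˢ type (successor x R)
  successor-seeded {x} {R} A∈ constraint =
    ∈ˢ-mono (closure-extensive _) (∈ˢ-select⁺ (constrains? (type x) (converse R)) A∈ constraint)

  witness-seeded : ∀ {x R B A} → A ∈ Names → B ≡ A ⊎ Constrains (type x) (converse R) A →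
                   A ∈ˢ type (witness x R B)
  witness-seeded {x} {R} {B} A∈ seeded =
    ∈ˢ-mono (closure-extensive _)
      (∈ˢ-select⁺ (λ B′ → (B ≟ B′) ⊎-dec constrains? (type x) (converse R) B′) A∈ seeded)

  type-closed : ∀ x → Closed (type x)
  type-closed (individual c)  = individualType-closed c
  type-closed (successor x R) = closure-closed _
  type-closed (witness x R B) = closure-closed _

  WitnessNeeded : Node → Role → ConceptName → Set
  WitnessNeeded x R B = R ∉ funcs × Demands (type x) R B

  mutual
    HasNeighbour : Node → Role → Set
    HasNeighbour (individual c)   R = AnyNeighbour D c (λ R′ _ → R′ ≡ R)
    HasNeighbour (successor x R′) R = R ≡ converse R′ × SuccessorNeeded x R′
    HasNeighbour (witness x R′ B) R = R ≡ converse R′ × WitnessNeeded x R′ B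

    SuccessorNeeded : Node → Role → Set
    SuccessorNeeded x R = R ∈ funcs × Triggers (type x) R × ¬ HasNeighbour x R

  witnessNeeded? : ∀ x R B → Dec (WitnessNeeded x R B)
  witnessNeeded? x R B = ¬? (functional? R) ×-dec demands? (type x) R B

  mutual
    hasNeighbour? : ∀ x R → Dec (HasNeighbour x R)
    hasNeighbour? (individual c)   R = anyNeighbour? D c (λ R′ _ → R′ ≟ᴿ R)
    hasNeighbour? (successor x R′) R = (R ≟ᴿ converse R′) ×-dec successorNeeded? x R′
    hasNeighbour? (witness x R′ B) R = (R ≟ᴿ converse R′) ×-dec witnessNeeded? x R′ B

    successorNeeded? : ∀ x R → Dec (SuccessorNeeded x R)
    successorNeeded? x R = functional? R ×-dec triggers? (type x) R ×-dec ¬? (hasNeighbour? x R)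

  data Link : Role → Node → Node → Set where
    fact-link       : ∀ {R c e} → RoleFactIn D R c e → Link R (individual c) (individual e)
    successor-link  : ∀ {R x} → SuccessorNeeded x R → Link R x (successor x R)
    successor-link⁻ : ∀ {R x} → SuccessorNeeded x R → Link (converse R) (successor x R) x
    witness-link    : ∀ {R x B} → WitnessNeeded x R B → Link R x (witness x R B)
    witness-link⁻   : ∀ {R x B} → WitnessNeeded x R B → Link (converse R) (witness x R B) x

  Link-converse : ∀ {R x y} → Link R x y → Link (converse R) y x
  Link-converse {R} (fact-link fact)     = fact-link (RoleFactIn-converse D R fact)
  Link-converse (successor-link needed)  = successor-link⁻ needed
  Link-converse (witness-link needed)    = witness-link⁻ needed
  Link-converse {y = y} (successor-link⁻ {R} needed) =
    subst (λ R′ → Link R′ y (successor y R)) (sym (converse-involutive R)) (successor-link needed)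
  Link-converse {y = y} (witness-link⁻ {R} {B = B} needed) =
    subst (λ R′ → Link R′ y (witness y R B)) (sym (converse-involutive R)) (witness-link needed)

  canonical : Interpretation
  canonical = record
    { Δ       = Node
    ; ind     = individual
    ; ind-inj = λ { _ _ refl → refl }
    ; conI    = λ A x → A ∈ˢ type x
    ; roleI   = λ r → Link (rn r)
    }

  link⁻ : ∀ R {x y} → roleExt canonical R x y → Link R x y
  link⁻ (rn r)  link = link
  link⁻ (inv r) link = Link-converse link

  link⁺ : ∀ R {x y} → Link R x y → roleExt canonical R x y
  link⁺ (rn r)  link = link
  link⁺ (inv r) link = Link-converse link

  module CanonicalModel
    (D-functional : ∀ {R c e e′} → R ∈ funcs → RoleFactIn D R c e → RoleFactIn D R c e′ → e ≡ e′) where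

    fires-successor : ∀ {x R A} → SuccessorNeeded x R → Constrains (type (successor x R)) R A →
                      Fires closure (type x) A
    fires-successor {x} {R} {A} (R∈ , triggered , _) constraint with find triggered
    ... | (B₁ , _ , B₂) , ax , refl , B₁∈ =
      inj₂ (inj₂ (lose ax (B₁∈ , subst (λ S → Constrains (closure S) R A)
                                         (sym (childSeed-functional B₂ R∈)) constraint)))

    fires-witness : ∀ {x R B A} → WitnessNeeded x R B → Constrains (type (witness x R B)) R A →
                    Fires closure (type x) A
    fires-witness {x} {R} {B} {A} (R∉ , demand) constraint with find demand
    ... | (B₁ , _ , _) , ax , refl , refl , B₁∈ =
      inj₂ (inj₂ (lose ax (B₁∈ , subst (λ S → Constrains (closure S) R A)
                                         (sym (childSeed-witness B R∉)) constraint)))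

    individual-constrained : ∀ {R c e A} → RoleFactIn D R c e → A ∈ Names →
                             Constrains (individualType e) R A → A ∈ˢ individualType c
    individual-constrained {R} {c} {e} {A} fact A∈ constraint =
      subst (A ∈ˢ_) (sym (individualType-adom c∈))
        (aboxTypes-constrained c∈ A∈
          (anyNeighbour⁺ R fact (subst (λ T → Constrains T R A) (individualType-adom e∈) constraint)))
      where
      c∈ = adom⊆constants D (roleFact-source D R fact)
      e∈ = adom⊆constants D (roleFact-source D (converse R) (RoleFactIn-converse D R fact))

    link-constrains : ∀ {R x y A} → Link R x y → A ∈ Names → Constrains (type y) R A → A ∈ˢ type x
    link-constrains (fact-link fact) A∈ constraint = individual-constrained fact A∈ constraint
    link-constrains {x = x} (successor-link needed) A∈ constraint =
      type-closed x A∈ (fires-successor {x} needed constraint)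
    link-constrains {x = x} (witness-link needed) A∈ constraint =
      type-closed x A∈ (fires-witness {x} needed constraint)
    link-constrains {y = y} (successor-link⁻ {R} _) A∈ constraint = successor-seeded {y} {R} A∈ constraint
    link-constrains {y = y} (witness-link⁻ {R} {B = B} _) A∈ constraint = witness-seeded {y} {R} {B} A∈ (inj₂ constraint)

    neighbour : ∀ {x R} → HasNeighbour x R → ∃[ y ] Link R x y
    neighbour {individual c} hasNeighbour with anyNeighbour⁻ hasNeighbour
    ... | _ , e , fact , refl = individual e , fact-link fact
    neighbour {successor z _} (refl , needed) = z , successor-link⁻ needed
    neighbour {witness z _ _} (refl , needed) = z , witness-link⁻ needed

    functional-neighbour : ∀ {x R} → R ∈ funcs → Triggers (type x) R → ∃[ y ] Link R x y
    functional-neighbour {x} {R} R∈ triggered with hasNeighbour? x R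
    ... | yes hasNeighbour = neighbour hasNeighbour
    ... | no  none         = successor x R , successor-link (R∈ , triggered , none)

    exists-sat : ∀ {A₁ R A₂} → (A₁ , R , A₂) ∈ exRights → SatAxiom canonical (name A₁ ⊑ ex R (name A₂))
    exists-sat {A₁} {R} {A₂} ax x A₁∈ with functional? R
    ... | no R∉ =
      witness x R A₂ , link⁺ R (witness-link (R∉ , lose ax (refl , refl , A₁∈))) ,
      witness-seeded {x} {R} {A₂} (exRight∈Names ax) (inj₁ refl)
    ... | yes R∈ with functional-neighbour R∈ (lose ax (refl , A₁∈))
    ...   | y , link = y , link⁺ R link ,
      link-constrains (Link-converse link) (exRight∈Names ax) (demanded-constrains R∈ (lose ax (refl , refl , A₁∈)))

    forces-sat : ∀ {R B C} → (R , B , C) ∈ exLefts → SatAxiom canonical (ex R (name B) ⊑ name C)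
    forces-sat {R} ax x (y , rel , B∈) =
      link-constrains (link⁻ R rel) (exLeft∈Names ax) (inj₁ (lose ax (refl , refl , B∈)))

    link-functional : ∀ {R x y y′} → R ∈ funcs → Link R x y → Link R x y′ → y ≡ y′
    link-functional R∈ (fact-link fact) (fact-link fact′) = cong individual (D-functional R∈ fact fact′)
    link-functional R∈ (fact-link fact) (successor-link (_ , _ , none)) = contradiction (anyNeighbour⁺ _ fact refl) none
    link-functional R∈ (successor-link (_ , _ , none)) (fact-link fact) = contradiction (anyNeighbour⁺ _ fact refl) none
    link-functional R∈ (successor-link _) (successor-link _) = refl
    link-functional R∈ (successor-link (_ , _ , none)) (successor-link⁻ needed) = contradiction (refl , needed) none
    link-functional R∈ (successor-link⁻ needed) (successor-link (_ , _ , none)) = contradiction (refl , needed) none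
    link-functional R∈ (successor-link (_ , _ , none)) (witness-link⁻ needed) = contradiction (refl , needed) none
    link-functional R∈ (witness-link⁻ needed) (successor-link (_ , _ , none)) = contradiction (refl , needed) none
    link-functional R∈ (successor-link⁻ _) (successor-link⁻ _) = refl
    link-functional R∈ (witness-link⁻ _) (witness-link⁻ _) = refl
    link-functional R∈ (witness-link (R∉ , _)) _ = contradiction R∈ R∉
    link-functional R∈ _ (witness-link (R∉ , _)) = contradiction R∈ R∉

    canonical-⊨D : ModelOfD canonical D
    canonical-⊨D = All.tabulate λ {f} → fact-sat f
      where
      fact-sat : ∀ f → f ∈ D → SatFact canonical f
      fact-sat (cfact A c) fact = subst (A ∈ˢ_) (sym (individualType-adom (adom⊆constants D (_ , fact , occ-c A))))
        (∈ˢ-mono (facts⊆aboxTypes c) (∈ˢ-select⁺ (λ A → ∈?[ _≟ᶠ_ ] (cfact A c) D) (fact∈Names fact) fact))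
      fact-sat (rfact r a b) fact = fact-link fact

    canonical-⊨N : canonical ⊨ₙ N
    canonical-⊨N = satisfies
      (All.tabulate λ ax x _ → type-closed x (top∈Names ax) (inj₁ ax))
      (All.tabulate λ ax x (A₁∈ , A₂∈) →
        type-closed x (conj∈Names ax) (inj₂ (inj₁ (lose ax (refl , A₁∈ , A₂∈)))))
      (All.tabulate exists-sat)
      (All.tabulate forces-sat)
      (All.tabulate λ R∈ x y y′ rel rel′ → link-functional R∈ (link⁻ _ rel) (link⁻ _ rel′))

  module Soundness {D′ : Database} {I : Interpretation} (I⊨D′ : ModelOfD I D′) (I⊨N : I ⊨ₙ N)
                   {Sim : Const → Const → Set} (sim : IsSimulation D D′ Sim) where

    open _⊨ₙ_ I⊨N

    Sat : Type → Δ I → Set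
    Sat T d = ∀ {A} → A ∈ˢ T → conI I A d

    Sound : (Type → Type) → Set
    Sound f = ∀ {K d} → Sat K d → Sat (f K) d

    sat-select : ∀ {P : ConceptName → Set} (P? : ∀ A → Dec (P A)) {d} →
                 (∀ {A} → P A → conI I A d) → Sat (select P?) d
    sat-select P? sound A∈ = sound (∈ˢ-select⁻ P? A∈)

    sat-∪ : ∀ {T T′ d} → Sat T d → Sat T′ d → Sat (T ∪ T′) d
    sat-∪ {T} {T′} sat sat′ A∈ with ∈ˢ-∪⁻ T T′ A∈
    ... | inj₁ A∈T  = sat A∈T
    ... | inj₂ A∈T′ = sat′ A∈T′

    demands-sound : ∀ {T R B d} → Sat T d → Demands T R B → ∃[ e ] roleExt I R d e × conI I B e
    demands-sound {d = d} sat demand with find demand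
    ... | _ , ax , refl , refl , A₁∈ = All.lookup exRights-sat ax d (sat A₁∈)

    constrains-sound : ∀ {T R A d e} → Sat T e → roleExt I R d e → Constrains T R A → conI I A d
    constrains-sound {d = d} {e} sat rel (inj₁ forces) with find forces
    ... | _ , ax , refl , refl , B∈ = All.lookup exLefts-sat ax d (e , rel , sat B∈)
    constrains-sound {R = R} {A} {d} {e} sat rel (inj₂ (functional , demand)) with demands-sound sat demand
    ... | d′ , rel′ , A-d′ =
      subst (conI I A) (All.lookup funcs-sat functional e d′ d rel′ (roleExt-converse I R rel)) A-d′

    seed-sound : ∀ {S R d e} → Sat S d → roleExt I R d e → Sat (seed S R) e
    seed-sound {S} {R} sat rel =
      sat-select (constrains? S (converse R)) (constrains-sound sat (roleExt-converse I R rel))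

    witnessSeed-sound : ∀ {S R B d e} → Sat S d → roleExt I R d e → conI I B e → Sat (witnessSeed S R B) e
    witnessSeed-sound {S} {R} {B} sat rel B-e =
      sat-select (λ B′ → (B ≟ B′) ⊎-dec constrains? S (converse R) B′) λ
        { (inj₁ refl)       → B-e
        ; (inj₂ constraint) → constrains-sound sat (roleExt-converse I R rel) constraint }

    childSeed-sound : ∀ {f} → Sound f → ∀ {S R B d e} → Sat S d → roleExt I R d e → conI I B e →
                      Sat (f (childSeed S R B)) e
    childSeed-sound f-sound {R = R} sat rel B-e with functional? R
    ... | yes _ = f-sound (seed-sound sat rel)
    ... | no  _ = f-sound (witnessSeed-sound sat rel B-e)

    fires-sound : ∀ {f} → Sound f → ∀ {S A d} → Sat S d → Fires f S A → conI I A d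
    fires-sound f-sound {d = d} sat (inj₁ A∈tops) = All.lookup tops-sat A∈tops d _
    fires-sound f-sound {d = d} sat (inj₂ (inj₁ conj)) with find conj
    ... | _ , ax , refl , B₁∈ , B₂∈ = All.lookup conjs-sat ax d (sat B₁∈ , sat B₂∈)
    fires-sound f-sound {d = d} sat (inj₂ (inj₂ exists)) with find exists
    ... | _ , ax , B₁∈ , constraint with All.lookup exRights-sat ax d (sat B₁∈)
    ...   | e , rel , B₂-e = constrains-sound (childSeed-sound f-sound sat rel B₂-e) rel constraint

    rules-sound : ∀ {f} → Sound f → Sound (rules f)
    rules-sound {f} f-sound {K} sat = sat-select (fires? f K) (fires-sound f-sound sat)

    closure-sound : Sound closure
    closure-sound = closure-induction Sound (λ sat → sat) λ f-sound sat →
      sat-∪ (f-sound sat) (rules-sound f-sound (f-sound sat))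

    SimulationSound : (Const → Type) → Set
    SimulationSound g = ∀ {c c′} → Sim c c′ → Sat (g c) (ind I c′)

    facts-sound : SimulationSound facts
    facts-sound {c} {c′} s = sat-select (λ A → ∈?[ _≟ᶠ_ ] (cfact A c) D)
      λ {A} fact → All.lookup I⊨D′ (IsSimulation.atom sim A c c′ fact s)

    neighbourConstraints-sound : ∀ {g} → SimulationSound g → SimulationSound (neighbourConstraints g)
    neighbourConstraints-sound {g} g-sound {c} {c′} s =
      sat-select (λ A → anyNeighbour? D c (λ R e → constrains? (g e) R A)) λ neighbour →
      let R , e , fact , constraint = anyNeighbour⁻ neighbour
          e′ , fact′ , s′ = IsSimulation.edge sim R c e c′ fact s
      in constrains-sound (g-sound s′) (roleFact-sat I⊨D′ R fact′) constraint

    aboxTypes-sound : SimulationSound aboxTypes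
    aboxTypes-sound = aboxTypes-induction SimulationSound facts-sound λ g-sound s →
      sat-∪ (g-sound s) (sat-∪ (rules-sound closure-sound (g-sound s)) (neighbourConstraints-sound g-sound s))

    individualType-sound : SimulationSound individualType
    individualType-sound {c} s with ∈?[ _≟_ ] c (constants D)
    ... | yes _ = aboxTypes-sound s
    ... | no  _ = closure-sound (aboxTypes-sound s)

lemma5 : (O : Ontology) → NormalForm O →
         (D₁ D₂ : Database) → Satisfiable D₁ O → Satisfiable D₂ O →
         (c₁ c₂ : Const) → InAdom c₁ D₁ → InAdom c₂ D₂ →
         Simulated D₁ c₁ D₂ c₂ →
         (A : ConceptName) → Entails D₁ O A c₁ → Entails D₂ O A c₂
lemma5 O nf D₁ D₂ (K , K⊨D₁ , K⊨O) _ c₁ c₂ _ _ (_ , sim , c₁Sc₂) A D₁⊨A I I⊨D₂ I⊨O =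
  individualType-sound c₁Sc₂ (D₁⊨A canonical canonical-⊨D (normalise-⊨ O nf canonical-⊨N))
  where
  open Canonical (normalise O nf) D₁
  open CanonicalModel (functional-facts K⊨D₁ (⊨-normalise O nf K⊨O))
  open Soundness I⊨D₂ (⊨-normalise O nf I⊨O) sim
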